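{- Let $G$ be a complete split graph with vertex bipartition $P\cup Q$, where $P$ induces a clique, $Q$ induces an independent set, every vertex of $P$ is adjacent to every vertex of $Q$, $|P|=p$ and $|Q|=q$. For every integer $k$ with $1\leq k\leq q$, the face complex of the graph associahedron $\mathcal{A}(G)$ contains at least $p\binom{q}{k}$ different faces that are (combinatorially) copies of the $(p+k-2)$-dimensional permutohedron.
   Context: For a connected graph $G$ on $n$ vertices, a tubing is a collection of non-empty proper subsets of the vertex set (tubes) such that each tube induces a connected subgraph and any two distinct tubes are either nested (one contains the other) or non-adjacent (their union induces a disconnected subgraph). The graph associahedron $\mathcal{A}(G)$ is an $(n-1)$-dimensional polytope whose face lattice is isomorphic to the set of tubings of $G$ ordered by reverse inclusion; its vertices correspond to maximal tubings (of size $n-1$), equivalently to search trees on $G$, and its edges to rotations. The permutohedron of dimension $d$ is the polytope whose vertices are the permutations of $d+1$ elements and whose edges correspond to transpositions of consecutive entries. -}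

module Defs where

open import Data.Nat using (ℕ; suc; _<_; _+_)
open import Data.Bool using (Bool; true)
open import Data.Fin using (Fin; toℕ) renaming (_≤_ to _≤ᶠ_)
open import Data.Fin.Subset using (Subset; _∈_; _∉_; _⊆_; _∪_; Nonempty)
open import Data.Product using (Σ; ∃; _×_; _,_; proj₁)
open import Data.Sum using (_⊎_)
open import Relation.Nullary using (¬_)
open import Relation.Binary.PropositionalEquality using (_≡_; _≢_)
open import Function.Bundles using (_⇔_)

Graph : ℕ → Set₁
Graph n = Fin n → Fin n → Set

-- Vertices are Fin (p + q); P = {v | toℕ v < p}, Q = the remaining q vertices.
SplitAdj : (p q : ℕ) → Graph (p + q)
SplitAdj p q u v = u ≢ v × (toℕ u < p ⊎ toℕ v < p)

module _ {n : ℕ} (G : Graph n) where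

  data PathIn (S : Subset n) : Fin n → Fin n → Set where
    here : ∀ {u} → u ∈ S → PathIn S u u
    step : ∀ {u v w} → u ∈ S → G u v → PathIn S v w → PathIn S u w

  InducesConnected : Subset n → Set
  InducesConnected S = Nonempty S × (∀ u v → u ∈ S → v ∈ S → PathIn S u v)

  IsTube : Subset n → Set
  IsTube S = InducesConnected S × ∃ (λ v → v ∉ S)

  -- two tubes are compatible: nested, or non-adjacent (union disconnected)
  Compatible : Subset n → Subset n → Set
  Compatible s t = (s ⊆ t ⊎ t ⊆ s) ⊎ ¬ InducesConnected (s ∪ t)

Collection : ℕ → Set
Collection n = Subset n → Bool

module _ {n : ℕ} (G : Graph n) where

  IsTubing : Collection n → Set
  IsTubing T = (∀ s → T s ≡ true → IsTube G s)
             × (∀ s t → T s ≡ true → T t ≡ true → Compatible G s t)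

  -- Faces of the face of A(G) corresponding to the tubing T:
  -- the tubings containing T.
  FacesBelow : Collection n → Set
  FacesBelow T = Σ (Collection n) λ S → IsTubing S × (∀ s → T s ≡ true → S s ≡ true)

-- face order on tubings = reverse inclusion: S ≤ S' iff S' ⊆ S
_≤ᵀ_ : ∀ {n} → Collection n → Collection n → Set
S ≤ᵀ S' = ∀ s → S' s ≡ true → S s ≡ true

-- Face poset of the permutohedron on m elements (dimension m - 1):
-- non-empty faces ↔ ordered set partitions of Fin m into r blocks,
-- encoded as a surjection f : Fin m → Fin r sending an element to its block.
OrderedPartition : ℕ → Set
OrderedPartition m = Σ ℕ λ r → Σ (Fin m → Fin r) λ f → ∀ b → ∃ λ a → f a ≡ b

-- face inclusion F ⊆ F' iff F' is obtained from F by merging consecutive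
-- blocks, i.e. f' = g ∘ f for a monotone g
_≤ᴾ_ : ∀ {m} → OrderedPartition m → OrderedPartition m → Set
(r , f , _) ≤ᴾ (r' , f' , _) =
  Σ (Fin r → Fin r') λ g → (∀ i j → i ≤ᶠ j → g i ≤ᶠ g j) × (∀ a → f' a ≡ g (f a))

-- order isomorphism of (pre)ordered sets (isomorphism of the quotient posets)
OrderIso : (A : Set) → (A → A → Set) → (B : Set) → (B → B → Set) → Set
OrderIso A _≤A_ B _≤B_ =
  Σ (A → B) λ φ → (∀ a a' → (a ≤A a') ⇔ (φ a ≤B φ a'))
                × (∀ b → ∃ λ a → (φ a ≤B b) × (b ≤B φ a))

IsPermutohedronFace : ∀ {n} → Graph n → Collection n → ℕ → Set
IsPermutohedronFace G T d =
  OrderIso (FacesBelow G T) (λ x y → proj₁ x ≤ᵀ proj₁ y)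
           (OrderedPartition (suc d)) _≤ᴾ_

-- Fix a vertex x of P and a k-subset K of Q, and let X = {x} ∪ (Q ∖ K). The tubing T
-- formed by X and the singletons {w}, w ∈ Q ∖ K, determines (x, K), so there are
-- p · (q choose k) of them. Any tube compatible with T either lies in T or contains X, and
-- the tubes containing X contain the universal vertex x, hence are pairwise nested. So the
-- tubings containing T are T plus a chain of proper supersets of X, i.e. an ordered set
-- partition of the p - 1 + k vertices outside X: the face poset of the permutohedron of
-- dimension p + k - 2. A tubing S ⊇ T ranks a vertex a ∉ X by the size of the greatest tube
-- of S containing X but not a; an ordered partition is realised by its initial segments.
module Submission where

open import Defs
open import Data.Nat using (ℕ; zero; suc; _+_; _*_; _∸_; _≤_; _<_; _<?_; _≤′_; ≤′-reflexive; ≤′-step; z≤n; s≤s; _⊔_)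
open import Data.Nat.Properties
  using ( ≤-refl; ≤-trans; ≤-antisym; ≤-reflexive; ≤-total; ≤-pred; <-≤-trans; ≤-<-trans; <⇒≱; ≮⇒≥; ≤⇒≤′
        ; m≤n⇒m≤1+n; m≤m⊔n; m≤n⊔m; m≤n⇒m<n∨m≡n; m≤m+n; +-suc; suc-injective; _≟_)
open import Data.Nat.Combinatorics using (_C_; nCk+nC[k+1]≡[n+1]C[k+1])
open import Data.Bool as Bool using (true; false; not)
open import Data.Bool.Properties using (not-involutive)
open import Data.Fin as Fin using (Fin; toℕ; fromℕ<; cast; _↑ˡ_; _↑ʳ_; splitAt; join; remQuot; combine)
open import Data.Fin.Properties
  using ( toℕ-fromℕ<; toℕ-injective; toℕ<n; toℕ-cast; toℕ-↑ˡ; toℕ-↑ʳ; ↑ʳ-injective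
        ; splitAt⁻¹-↑ˡ; splitAt⁻¹-↑ʳ; join-splitAt; combine-remQuot; any?)
open import Data.Fin.Subset using (Subset; _∈_; _∉_; _⊆_; _⊂_; _⊃_; _∪_; ⁅_⁆; ∁; ∣_∣; Nonempty; ⊥)
open import Data.Fin.Subset.Properties
  using ( _∈?_; _⊆?_; _⊂?_; anySubset?; nonempty?; Empty-unique; ⊆-refl; ⊆-trans; ⊆-antisym
        ; p⊆p∪q; q⊆p∪q; x∈p∪q⁻; x∈⁅x⁆; x∈⁅y⁆⇒x≡y; x∈∁p⇒x∉p; x∉p⇒x∈∁p
        ; p⊆q⇒∣p∣≤∣q∣; p⊂q⇒∣p∣<∣q∣; ∣∁p∣≡n∸∣p∣; ∣⁅x⁆∣≡1; ∣⊥∣≡0)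
open import Data.Fin.Subset.Induction using (⊂-wellFounded; ⊃-wellFounded; Acc; acc)
open import Data.Vec using ([]; _∷_; _++_; here; there; tabulate)
open import Data.Vec.Properties
  using (≡-dec; ∷-injective; ++-injective; map-++; lookup-++ˡ; lookup-++ʳ; lookup∘tabulate; []=⇒lookup; lookup⇒[]=)
open import Data.Product using (Σ; ∃; _×_; _,_; proj₁; proj₂; map₂; uncurry)
open import Data.Sum using (_⊎_; inj₁; inj₂; [_,_]′)
open import Function using (_∘_)
open import Function.Bundles using (_⇔_; mk⇔; Equivalence)
open import Function.Properties.Equivalence using () renaming (trans to ⇔-trans)
open import Relation.Nullary using (¬_; Dec; yes; no; does; contradiction)
open import Relation.Nullary.Decidable using (dec-true; decidable-stable; _×-dec_; _⊎-dec_; ¬?)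
open import Relation.Unary using (Decidable)
open import Relation.Binary.PropositionalEquality
  using (_≡_; _≢_; refl; sym; trans; cong; cong₂; subst; subst₂; module ≡-Reasoning)

does≡true⇒ : ∀ {A : Set} (a? : Dec A) → does a? ≡ true → A
does≡true⇒ (yes a) _ = a

does≡true⇔ : ∀ {A : Set} (a? : Dec A) → does a? ≡ true ⇔ A
does≡true⇔ a? = mk⇔ (does≡true⇒ a?) (dec-true a?)

subsetOf : ∀ {n} {P : Fin n → Set} → Decidable P → Subset n
subsetOf P? = tabulate (does ∘ P?)

∈subsetOf⇔ : ∀ {n} {P : Fin n → Set} (P? : Decidable P) {v} → v ∈ subsetOf P? ⇔ P v
∈subsetOf⇔ P? {v} = mk⇔
  (λ v∈ → does≡true⇒ (P? v) (trans (sym (lookup∘tabulate _ v)) ([]=⇒lookup v∈)))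
  (λ Pv → lookup⇒[]= v _ (trans (lookup∘tabulate _ v) (dec-true (P? v) Pv)))

⊆⊎∃∉ : ∀ {n} (p q : Subset n) → p ⊆ q ⊎ ∃ λ v → v ∈ p × v ∉ q
⊆⊎∃∉ p q with any? (λ v → v ∈? p ×-dec ¬? (v ∈? q))
... | yes escapee = inj₂ escapee
... | no none = inj₁ λ {v} v∈p → decidable-stable (v ∈? q) λ v∉q → none (v , v∈p , v∉q)

⊆∧⊄⇒⊇ : ∀ {n} {p q : Subset n} → p ⊆ q → ¬ p ⊂ q → q ⊆ p
⊆∧⊄⇒⊇ {p = p} {q} p⊆q p⊄q with ⊆⊎∃∉ q p
... | inj₁ q⊆p = q⊆p
... | inj₂ (v , v∈q , v∉p) = contradiction ((λ {w} → p⊆q {w}) , v , v∈q , v∉p) p⊄q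

∁-involutive : ∀ {n} (s : Subset n) → ∁ (∁ s) ≡ s
∁-involutive [] = refl
∁-involutive (b ∷ s) = cong₂ _∷_ (not-involutive b) (∁-involutive s)

∣++∣ : ∀ {m n} (a : Subset m) (b : Subset n) → ∣ a ++ b ∣ ≡ ∣ a ∣ + ∣ b ∣
∣++∣ [] b = refl
∣++∣ (true ∷ a) b = cong suc (∣++∣ a b)
∣++∣ (false ∷ a) b = ∣++∣ a b

module _ {m n} (a : Subset m) (b : Subset n) where

  ∈-++ˡ⇔ : ∀ {i} → i ↑ˡ n ∈ a ++ b ⇔ i ∈ a
  ∈-++ˡ⇔ {i} = mk⇔
    (λ i∈ → lookup⇒[]= i a (trans (sym (lookup-++ˡ a b i)) ([]=⇒lookup i∈)))
    (λ i∈ → lookup⇒[]= (i ↑ˡ n) (a ++ b) (trans (lookup-++ˡ a b i) ([]=⇒lookup i∈)))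

  ∈-++ʳ⇔ : ∀ {w} → m ↑ʳ w ∈ a ++ b ⇔ w ∈ b
  ∈-++ʳ⇔ {w} = mk⇔
    (λ w∈ → lookup⇒[]= w b (trans (sym (lookup-++ʳ a b w)) ([]=⇒lookup w∈)))
    (λ w∈ → lookup⇒[]= (m ↑ʳ w) (a ++ b) (trans (lookup-++ʳ a b w) ([]=⇒lookup w∈)))

↑ˡ⊎↑ʳ : ∀ m {n} (v : Fin (m + n)) → (∃ λ i → v ≡ i ↑ˡ n) ⊎ (∃ λ w → v ≡ m ↑ʳ w)
↑ˡ⊎↑ʳ m v with splitAt m v in eq
... | inj₁ i = inj₁ (i , sym (splitAt⁻¹-↑ˡ eq))
... | inj₂ w = inj₂ (w , sym (splitAt⁻¹-↑ʳ eq))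

∣∣≡suc⇒nonempty : ∀ {n m} (s : Subset n) → ∣ s ∣ ≡ suc m → Nonempty s
∣∣≡suc⇒nonempty {n} s ∣s∣≡ with nonempty? s
... | yes s-nonempty = s-nonempty
... | no s-empty = contradiction (trans (sym ∣s∣≡) ∣s∣≡0) λ ()
  where
  ∣s∣≡0 : ∣ s ∣ ≡ 0
  ∣s∣≡0 = trans (cong ∣_∣ (Empty-unique s-empty)) (∣⊥∣≡0 n)

module _ {n} {P : Subset n → Set} (P? : Decidable P)
         (P-chain : ∀ {s t} → P s → P t → s ⊆ t ⊎ t ⊆ s) where

  greatest : ∃ P → ∃ λ M → P M × (∀ {t} → P t → t ⊆ M)
  greatest (t , Pt) = go (⊃-wellFounded t) Pt
    where
    go : ∀ {t} → Acc _⊃_ t → P t → ∃ λ M → P M × (∀ {u} → P u → u ⊆ M)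
    go {t} (acc larger) Pt with anySubset? (λ u → P? u ×-dec t ⊂? u)
    ... | yes (u , Pu , t⊂u) = go (larger t⊂u) Pu
    ... | no none = t , Pt , below
      where
      below : ∀ {u} → P u → u ⊆ t
      below {u} Pu with P-chain Pu Pt
      ... | inj₁ u⊆t = u⊆t
      ... | inj₂ t⊆u = ⊆∧⊄⇒⊇ t⊆u λ t⊂u → none (u , Pu , t⊂u)

  least : ∃ P → ∃ λ m → P m × (∀ {t} → P t → m ⊆ t)
  least (t , Pt) = go (⊂-wellFounded t) Pt
    where
    go : ∀ {t} → Acc _⊂_ t → P t → ∃ λ m → P m × (∀ {u} → P u → m ⊆ u)
    go {t} (acc smaller) Pt with anySubset? (λ u → P? u ×-dec u ⊂? t)
    ... | yes (u , Pu , u⊂t) = go (smaller u⊂t) Pu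
    ... | no none = t , Pt , above
      where
      above : ∀ {u} → P u → t ⊆ u
      above {u} Pu with P-chain Pu Pt
      ... | inj₁ u⊆t = ⊆∧⊄⇒⊇ u⊆t λ u⊂t → none (u , Pu , u⊂t)
      ... | inj₂ t⊆u = t⊆u

nth : ∀ {n} (s : Subset n) → Fin ∣ s ∣ → Fin n
nth (true ∷ s) Fin.zero = Fin.zero
nth (true ∷ s) (Fin.suc j) = Fin.suc (nth s j)
nth (false ∷ s) j = Fin.suc (nth s j)

nth∈ : ∀ {n} (s : Subset n) j → nth s j ∈ s
nth∈ (true ∷ s) Fin.zero = here
nth∈ (true ∷ s) (Fin.suc j) = there (nth∈ s j)
nth∈ (false ∷ s) j = there (nth∈ s j)

position : ∀ {n} → Subset n → Fin n → ℕ
position (_ ∷ s) Fin.zero = zero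
position (true ∷ s) (Fin.suc v) = suc (position s v)
position (false ∷ s) (Fin.suc v) = position s v

position-nth : ∀ {n} (s : Subset n) j → position s (nth s j) ≡ toℕ j
position-nth (true ∷ s) Fin.zero = refl
position-nth (true ∷ s) (Fin.suc j) = cong suc (position-nth s j)
position-nth (false ∷ s) j = position-nth s j

position<∣∣ : ∀ {n} (s : Subset n) {v} → v ∈ s → position s v < ∣ s ∣
position<∣∣ (true ∷ s) here = s≤s z≤n
position<∣∣ (true ∷ s) (there v∈s) = s≤s (position<∣∣ s v∈s)
position<∣∣ (false ∷ s) (there v∈s) = position<∣∣ s v∈s

nth-position : ∀ {n} (s : Subset n) j {v} → v ∈ s → toℕ j ≡ position s v → nth s j ≡ v
nth-position (true ∷ s) Fin.zero here _ = refl
nth-position (true ∷ s) (Fin.suc j) (there v∈s) eq = cong Fin.suc (nth-position s j v∈s (suc-injective eq))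
nth-position (false ∷ s) j (there v∈s) eq = cong Fin.suc (nth-position s j v∈s eq)

module Enumeration {n} (s : Subset n) {d} (∣s∣≡ : ∣ s ∣ ≡ suc d) where

  elem : Fin (suc d) → Fin n
  elem j = nth s (cast (sym ∣s∣≡) j)

  elem∈ : ∀ j → elem j ∈ s
  elem∈ j = nth∈ s _

  -- junk value zero for vertices outside s
  index : Fin n → Fin (suc d)
  index v with position s v <? suc d
  ... | yes lt = fromℕ< lt
  ... | no _ = Fin.zero

  private
    toℕ-index : ∀ v → position s v < suc d → toℕ (index v) ≡ position s v
    toℕ-index v lt with position s v <? suc d
    ... | yes lt' = toℕ-fromℕ< lt'
    ... | no ¬lt = contradiction lt ¬lt

    position-elem : ∀ j → position s (elem j) ≡ toℕ j
    position-elem j = trans (position-nth s _) (toℕ-cast (sym ∣s∣≡) j)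

  index-elem : ∀ j → index (elem j) ≡ j
  index-elem j = toℕ-injective (trans (toℕ-index (elem j) (subst (_< suc d) (sym (position-elem j)) (toℕ<n j)))
                                      (position-elem j))

  elem-index : ∀ {v} → v ∈ s → elem (index v) ≡ v
  elem-index {v} v∈s =
    nth-position s _ v∈s (trans (toℕ-cast (sym ∣s∣≡) (index v)) (toℕ-index v position<))
    where
    position< : position s v < suc d
    position< = subst (position s v <_) ∣s∣≡ (position<∣∣ s v∈s)

-- Ordered partitions from a ranking

module _ {P : ℕ → Set} (P? : Decidable P) where

  countBelow : ℕ → ℕ
  countBelow zero = zero
  countBelow (suc t) with P? t
  ... | yes _ = suc (countBelow t)
  ... | no _ = countBelow t

  countBelow-step : ∀ t → countBelow t ≤ countBelow (suc t)
  countBelow-step t with P? t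
  ... | yes _ = m≤n⇒m≤1+n ≤-refl
  ... | no _ = ≤-refl

  countBelow-step-< : ∀ {t} → P t → countBelow t < countBelow (suc t)
  countBelow-step-< {t} Pt with P? t
  ... | yes _ = ≤-refl
  ... | no ¬Pt = contradiction Pt ¬Pt

  countBelow-mono : ∀ {t t'} → t ≤ t' → countBelow t ≤ countBelow t'
  countBelow-mono = mono′ ∘ ≤⇒≤′
    where
    mono′ : ∀ {t t'} → t ≤′ t' → countBelow t ≤ countBelow t'
    mono′ (≤′-reflexive refl) = ≤-refl
    mono′ (≤′-step {t'} le) = ≤-trans (mono′ le) (countBelow-step t')

  countBelow-< : ∀ {t t'} → P t → t < t' → countBelow t < countBelow t'
  countBelow-< Pt t<t' = <-≤-trans (countBelow-step-< Pt) (countBelow-mono t<t')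

  countBelow-onto : ∀ N {i} → i < countBelow N → ∃ λ t → P t × countBelow t ≡ i
  countBelow-onto (suc N) i< with P? N
  ... | no _ = countBelow-onto N i<
  ... | yes PN with m≤n⇒m<n∨m≡n (≤-pred i<)
  ...   | inj₁ i<N = countBelow-onto N i<N
  ...   | inj₂ refl = N , PN , refl

maximum : ∀ {m} → (Fin m → ℕ) → ℕ
maximum {zero} h = zero
maximum {suc m} h = h Fin.zero ⊔ maximum (h ∘ Fin.suc)

≤-maximum : ∀ {m} (h : Fin m → ℕ) a → h a ≤ maximum h
≤-maximum h Fin.zero = m≤m⊔n _ _
≤-maximum h (Fin.suc a) = ≤-trans (≤-maximum (h ∘ Fin.suc) a) (m≤n⊔m _ _)

block : ∀ {m} (O : OrderedPartition m) → Fin m → Fin (proj₁ O)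
block (_ , f , _) = f

_≲[_]_ : ∀ {m} → Fin m → OrderedPartition m → Fin m → Set
a ≲[ O ] b = block O a Fin.≤ block O b

≤ᴾ⇔≲-preserving : ∀ {m} (O O' : OrderedPartition m) →
  O ≤ᴾ O' ⇔ (∀ a b → a ≲[ O ] b → a ≲[ O' ] b)
≤ᴾ⇔≲-preserving (r , f , f-onto) (r' , f' , f'-onto) = mk⇔ preserving merging
  where
  preserving : (r , f , f-onto) ≤ᴾ (r' , f' , f'-onto) → ∀ a b → f a Fin.≤ f b → f' a Fin.≤ f' b
  preserving (g , g-mono , f'≡g∘f) a b fa≤fb
    rewrite f'≡g∘f a | f'≡g∘f b = g-mono (f a) (f b) fa≤fb
  merging : (∀ a b → f a Fin.≤ f b → f' a Fin.≤ f' b) → (r , f , f-onto) ≤ᴾ (r' , f' , f'-onto)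
  merging H = g , g-mono , f'≡g∘f
    where
    rep : Fin r → Fin _
    rep i = proj₁ (f-onto i)
    g : Fin r → Fin r'
    g i = f' (rep i)
    g-mono : ∀ i j → i Fin.≤ j → g i Fin.≤ g j
    g-mono i j i≤j = H (rep i) (rep j) (subst₂ Fin._≤_ (sym (f-rep i)) (sym (f-rep j)) i≤j)
      where f-rep = λ i → proj₂ (f-onto i)
    f'≡g∘f : ∀ a → f' a ≡ g (f a)
    f'≡g∘f a = toℕ-injective (≤-antisym (H a (rep (f a)) (≤-reflexive (cong toℕ (sym f-rep))))
                                         (H (rep (f a)) a (≤-reflexive (cong toℕ f-rep))))
      where f-rep = proj₂ (f-onto (f a))

module _ {m} (h : Fin m → ℕ) where

  private
    InImage : ℕ → Set
    InImage w = ∃ λ a → h a ≡ w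

    inImage? : Decidable InImage
    inImage? w = any? (λ a → h a ≟ w)

    rank : Fin m → ℕ
    rank a = countBelow inImage? (h a)

    blocks : ℕ
    blocks = countBelow inImage? (suc (maximum h))

    rank<blocks : ∀ a → rank a < blocks
    rank<blocks a = countBelow-< inImage? (a , refl) (s≤s (≤-maximum h a))

  rankPartition : OrderedPartition m
  rankPartition = blocks , (λ a → fromℕ< (rank<blocks a)) , onto
    where
    onto : ∀ i → ∃ λ a → fromℕ< (rank<blocks a) ≡ i
    onto i with countBelow-onto inImage? (suc (maximum h)) (toℕ<n i)
    ... | _ , (a , refl) , rank≡i = a , toℕ-injective (trans (toℕ-fromℕ< (rank<blocks a)) rank≡i)

  ≲-rankPartition⇔ : ∀ a b → a ≲[ rankPartition ] b ⇔ h a ≤ h b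
  ≲-rankPartition⇔ a b rewrite toℕ-fromℕ< (rank<blocks a) | toℕ-fromℕ< (rank<blocks b) =
    mk⇔ (λ ra≤rb → ≮⇒≥ λ hb<ha → <⇒≱ (countBelow-< inImage? (b , refl) hb<ha) ra≤rb)
        (countBelow-mono inImage?)

Independent : ∀ {n} → Graph n → Subset n → Set
Independent G S = ∀ {u v} → u ∈ S → v ∈ S → ¬ G u v

IsUniversal : ∀ {n} → Graph n → Fin n → Set
IsUniversal G x = ∀ v → v ≢ x → G x v × G v x

module _ {n} {G : Graph n} where

  _++ᵖ_ : ∀ {S u v w} → PathIn G S u v → PathIn G S v w → PathIn G S u w
  here _ ++ᵖ q = q
  step u∈S uv p ++ᵖ q = step u∈S uv (p ++ᵖ q)

  ⁅⁆-connected : ∀ z → InducesConnected G ⁅ z ⁆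
  ⁅⁆-connected z = (z , x∈⁅x⁆ z) , λ u v u∈ v∈ →
    subst (λ w → PathIn G ⁅ z ⁆ w v) (trans (x∈⁅y⁆⇒x≡y z v∈) (sym (x∈⁅y⁆⇒x≡y z u∈)))
          (here v∈)

  independent-connected⇒≡ : ∀ {S u v} → Independent G S → InducesConnected G S →
    u ∈ S → v ∈ S → u ≡ v
  independent-connected⇒≡ S-independent (_ , paths) u∈ v∈ = trivial (paths _ _ u∈ v∈)
    where
    trivial : ∀ {u v} → PathIn G _ u v → u ≡ v
    trivial (here _) = refl
    trivial (step u∈ uw (here w∈)) = contradiction uw (S-independent u∈ w∈)
    trivial (step u∈ uw (step w∈ _ _)) = contradiction uw (S-independent u∈ w∈)

  independent-connected⇒≡⁅⁆ : ∀ {S z} → Independent G S → InducesConnected G S →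
    z ∈ S → S ≡ ⁅ z ⁆
  independent-connected⇒≡⁅⁆ {S} {z} S-independent S-connected z∈S = ⊆-antisym S⊆⁅z⁆ ⁅z⁆⊆S
    where
    S⊆⁅z⁆ : S ⊆ ⁅ z ⁆
    S⊆⁅z⁆ v∈S =
      subst (_∈ ⁅ z ⁆) (independent-connected⇒≡ S-independent S-connected z∈S v∈S) (x∈⁅x⁆ z)
    ⁅z⁆⊆S : ⁅ z ⁆ ⊆ S
    ⁅z⁆⊆S v∈⁅z⁆ = subst (_∈ S) (sym (x∈⁅y⁆⇒x≡y z v∈⁅z⁆)) z∈S

  module _ {x} (x-universal : IsUniversal G x) where

    ∋-universal⇒connected : ∀ {S} → x ∈ S → InducesConnected G S
    ∋-universal⇒connected {S} x∈S = (x , x∈S) , λ u v u∈ v∈ → toX u∈ ++ᵖ fromX v∈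
      where
      toX : ∀ {u} → u ∈ S → PathIn G S u x
      toX {u} u∈ with u Fin.≟ x
      ... | yes refl = here u∈
      ... | no u≢x = step u∈ (proj₂ (x-universal u u≢x)) (here x∈S)
      fromX : ∀ {v} → v ∈ S → PathIn G S x v
      fromX {v} v∈ with v Fin.≟ x
      ... | yes refl = here v∈
      ... | no v≢x = step x∈S (proj₁ (x-universal v v≢x)) (here v∈)

    compatible-∋-universal⇒nested : ∀ {s t} → Compatible G s t → x ∈ s → s ⊆ t ⊎ t ⊆ s
    compatible-∋-universal⇒nested (inj₁ nested) _ = nested
    compatible-∋-universal⇒nested {s} {t} (inj₂ disconnected) x∈s =
      contradiction (∋-universal⇒connected (p⊆p∪q t x∈s)) disconnected

-- Faces of A(G) above a saturated tubing

module PermutohedralFace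
  {n} {G : Graph n} {x : Fin n} (x-universal : IsUniversal G x)
  {T₀ : Collection n} (T₀-tubing : IsTubing G T₀)
  {X : Subset n} (x∈X : x ∈ X) (X∈T₀ : T₀ X ≡ true) (T₀⊆X : ∀ s → T₀ s ≡ true → s ⊆ X)
  (T₀-saturated : ∀ S → IsTubing G S → S ≤ᵀ T₀ →
                    ∀ s → S s ≡ true → T₀ s ≡ true ⊎ X ⊆ s)
  {d} (∣∁X∣≡ : ∣ ∁ X ∣ ≡ suc d)
  where

  open Enumeration (∁ X) ∣∁X∣≡

  elem∉X : ∀ j → elem j ∉ X
  elem∉X j = x∈∁p⇒x∉p (elem∈ j)

  elem-index′ : ∀ {v} → v ∉ X → elem (index v) ≡ v
  elem-index′ v∉X = elem-index (x∉p⇒x∈∁p v∉X)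

  Over : Collection n → Subset n → Set
  Over S t = S t ≡ true × X ⊆ t

  over? : ∀ S → Decidable (Over S)
  over? S t = (S t Bool.≟ true) ×-dec (X ⊆? t)

  _≼[_]_ : Fin n → Collection n → Fin n → Set
  a ≼[ S ] b = ∀ {t} → Over S t → b ∈ t → a ∈ t

  ≼-antitone : ∀ {S S' a b} → S ≤ᵀ S' → a ≼[ S ] b → a ≼[ S' ] b
  ≼-antitone S≤S' a≼b (S't , X⊆t) = a≼b (S≤S' _ S't , X⊆t)

  module Chain {S} (S-tubing : IsTubing G S) (S≤T₀ : S ≤ᵀ T₀) where

    over-chain : ∀ {s t} → Over S s → Over S t → s ⊆ t ⊎ t ⊆ s
    over-chain (Ss , X⊆s) (St , _) =
      compatible-∋-universal⇒nested x-universal (proj₂ S-tubing _ _ Ss St) (X⊆s x∈X)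

    X-over : Over S X
    X-over = S≤T₀ X X∈T₀ , ⊆-refl

    GreatestAvoiding : Fin n → Subset n → Set
    GreatestAvoiding a M = (Over S M × a ∉ M) × (∀ {t} → Over S t × a ∉ t → t ⊆ M)

    greatest-avoiding : ∀ {a} → a ∉ X → ∃ (GreatestAvoiding a)
    greatest-avoiding {a} a∉X = greatest (λ t → over? S t ×-dec ¬? (a ∈? t))
      (λ (s-over , _) (t-over , _) → over-chain s-over t-over) (X , X-over , a∉X)

    ∣GreatestAvoiding∣-≤⇔≼ : ∀ {a b Ma Mb} → GreatestAvoiding a Ma → GreatestAvoiding b Mb →
      ∣ Ma ∣ ≤ ∣ Mb ∣ ⇔ a ≼[ S ] b
    ∣GreatestAvoiding∣-≤⇔≼ {a} {b} {Ma} {Mb}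
      ((Ma-over , a∉Ma) , Ma-greatest) ((Mb-over , b∉Mb) , Mb-greatest) = mk⇔ ≤⇒≼ ≼⇒≤
      where
      ≼⇒≤ : a ≼[ S ] b → ∣ Ma ∣ ≤ ∣ Mb ∣
      ≼⇒≤ a≼b = p⊆q⇒∣p∣≤∣q∣ (Mb-greatest (Ma-over , λ b∈Ma → a∉Ma (a≼b Ma-over b∈Ma)))
      ≤⇒≼ : ∣ Ma ∣ ≤ ∣ Mb ∣ → a ≼[ S ] b
      ≤⇒≼ Ma≤Mb {t} t-over b∈t with a ∈? t
      ... | yes a∈t = a∈t
      ... | no a∉t with over-chain t-over Mb-over
      ...   | inj₁ t⊆Mb = contradiction (t⊆Mb b∈t) b∉Mb
      ...   | inj₂ Mb⊆t = contradiction Ma≤Mb (<⇒≱ (p⊂q⇒∣p∣<∣q∣ Mb⊂Ma))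
        where
        t⊆Ma : t ⊆ Ma
        t⊆Ma = Ma-greatest (t-over , a∉t)
        Mb⊂Ma : Mb ⊂ Ma
        Mb⊂Ma = ⊆-trans Mb⊆t t⊆Ma , b , t⊆Ma b∈t , b∉Mb

    height : ∀ {a} → a ∉ X → ℕ
    height a∉X = ∣ proj₁ (greatest-avoiding a∉X) ∣

    height-≤⇔≼ : ∀ {a b} (a∉X : a ∉ X) (b∉X : b ∉ X) →
      height a∉X ≤ height b∉X ⇔ a ≼[ S ] b
    height-≤⇔≼ a∉X b∉X =
      ∣GreatestAvoiding∣-≤⇔≼ (proj₂ (greatest-avoiding a∉X)) (proj₂ (greatest-avoiding b∉X))

    greatest-within : ∀ {s} → X ⊆ s →
      ∃ λ M → (Over S M × M ⊆ s) × (∀ {t} → Over S t × t ⊆ s → t ⊆ M)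
    greatest-within {s} X⊆s = greatest (λ t → over? S t ×-dec t ⊆? s)
      (λ (s-over , _) (t-over , _) → over-chain s-over t-over) (X , X-over , X⊆s)

    below-outside : ∀ {s M v a₀} → (∀ {t} → Over S t × t ⊆ s → t ⊆ M) → a₀ ∉ s → v ∉ M →
      ∃ λ a → a ∉ s × a ≼[ S ] v
    below-outside {s} {M} {v} {a₀} M-greatest a₀∉s v∉M
      with anySubset? (λ t → over? S t ×-dec v ∈? t)
    ... | no none = a₀ , a₀∉s , λ t-over v∈t → contradiction (_ , t-over , v∈t) none
    ... | yes some with least (λ t → over? S t ×-dec v ∈? t)
                              (λ (s-over , _) (t-over , _) → over-chain s-over t-over) some
    ...   | m , (m-over , v∈m) , m-least with ⊆⊎∃∉ m s
    ...     | inj₁ m⊆s = contradiction (M-greatest (m-over , m⊆s) v∈m) v∉M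
    ...     | inj₂ (a , a∈m , a∉s) = a , a∉s , λ t-over v∈t → m-least (t-over , v∈t) a∈m

  module _ {S S'} (S-tubing : IsTubing G S) (S≤T₀ : S ≤ᵀ T₀)
           (S'-tubing : IsTubing G S') (S'≤T₀ : S' ≤ᵀ T₀)
           (reflect : ∀ {a b} → a ∉ X → b ∉ X → a ≼[ S ] b → a ≼[ S' ] b) where

    open Chain S-tubing S≤T₀

    private
      -- s is a down-set of ≼[ S' ], hence of ≼[ S ], so the greatest S-tube inside s is s.
      over-in-S : ∀ {s} → S' s ≡ true → X ⊆ s → S s ≡ true
      over-in-S {s} S's X⊆s with greatest-within X⊆s | proj₂ (proj₁ S'-tubing s S's)
      ... | M , (M-over , M⊆s) , M-greatest | a₀ , a₀∉s =
        subst (λ t → S t ≡ true) (⊆-antisym M⊆s s⊆M) (proj₁ M-over)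
        where
        s⊆M : s ⊆ M
        s⊆M {v} v∈s with v ∈? M
        ... | yes v∈M = v∈M
        ... | no v∉M with below-outside M-greatest a₀∉s v∉M
        ...   | a , a∉s , a≼v = contradiction (reflect a∉X v∉X a≼v (S's , X⊆s) v∈s) a∉s
          where
          a∉X : a ∉ X
          a∉X a∈X = a∉s (X⊆s a∈X)
          v∉X : v ∉ X
          v∉X v∈X = v∉M (proj₂ M-over v∈X)

    ≼-reflecting⇒≤ᵀ : S ≤ᵀ S'
    ≼-reflecting⇒≤ᵀ s S's with T₀-saturated S' S'-tubing S'≤T₀ s S's
    ... | inj₁ T₀s = S≤T₀ s T₀s
    ... | inj₂ X⊆s = over-in-S S's X⊆s

  φ : FacesBelow G T₀ → OrderedPartition (suc d)
  φ (S , S-tubing , S≤T₀) = rankPartition (λ j → height (elem∉X j))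
    where open Chain S-tubing S≤T₀

  ≲-φ⇔≼ : ∀ A j j' → j ≲[ φ A ] j' ⇔ elem j ≼[ proj₁ A ] elem j'
  ≲-φ⇔≼ (S , S-tubing , S≤T₀) j j' =
    ⇔-trans (≲-rankPartition⇔ _ j j') (height-≤⇔≼ (elem∉X j) (elem∉X j'))
    where open Chain S-tubing S≤T₀

  ≤ᴾ-φ⇔≼-preserving : ∀ A A' →
    φ A ≤ᴾ φ A' ⇔ (∀ {a b} → a ∉ X → b ∉ X → a ≼[ proj₁ A ] b → a ≼[ proj₁ A' ] b)
  ≤ᴾ-φ⇔≼-preserving A A' = ⇔-trans (≤ᴾ⇔≲-preserving (φ A) (φ A')) (mk⇔ on-vertices on-indices)
    where
    open Equivalence
    on-vertices : (∀ j j' → j ≲[ φ A ] j' → j ≲[ φ A' ] j') →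
      ∀ {a b} → a ∉ X → b ∉ X → a ≼[ proj₁ A ] b → a ≼[ proj₁ A' ] b
    on-vertices H a∉X b∉X a≼b =
      subst₂ (_≼[ proj₁ A' ]_) (elem-index′ a∉X) (elem-index′ b∉X)
        (to (≲-φ⇔≼ A' _ _) (H _ _ (from (≲-φ⇔≼ A _ _)
          (subst₂ (_≼[ proj₁ A ]_) (sym (elem-index′ a∉X)) (sym (elem-index′ b∉X)) a≼b))))
    on-indices : (∀ {a b} → a ∉ X → b ∉ X → a ≼[ proj₁ A ] b → a ≼[ proj₁ A' ] b) →
      ∀ j j' → j ≲[ φ A ] j' → j ≲[ φ A' ] j'
    on-indices H j j' =
      from (≲-φ⇔≼ A' j j') ∘ H (elem∉X j) (elem∉X j') ∘ to (≲-φ⇔≼ A j j')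

  φ-≤⇔ : ∀ A A' → proj₁ A ≤ᵀ proj₁ A' ⇔ φ A ≤ᴾ φ A'
  φ-≤⇔ A@(S , S-tubing , S≤T₀) A'@(S' , S'-tubing , S'≤T₀) = mk⇔
    (λ S≤S' → from (≤ᴾ-φ⇔≼-preserving A A') λ _ _ → ≼-antitone S≤S')
    (≼-reflecting⇒≤ᵀ S-tubing S≤T₀ S'-tubing S'≤T₀ ∘ to (≤ᴾ-φ⇔≼-preserving A A'))
    where open Equivalence

  module Levels (O : OrderedPartition (suc d)) where

    open Equivalence

    InLevel : ℕ → Fin n → Set
    InLevel i v = v ∈ X ⊎ toℕ (block O (index v)) < i

    inLevel? : ∀ i → Decidable (InLevel i)
    inLevel? i v = v ∈? X ⊎-dec toℕ (block O (index v)) <? i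

    level : ℕ → Subset n
    level i = subsetOf (inLevel? i)

    ∈level⇔ : ∀ i {v} → v ∈ level i ⇔ InLevel i v
    ∈level⇔ i = ∈subsetOf⇔ (inLevel? i)

    X⊆level : ∀ i → X ⊆ level i
    X⊆level i v∈X = from (∈level⇔ i) (inj₁ v∈X)

    level-mono : ∀ {i i'} → i ≤ i' → level i ⊆ level i'
    level-mono {i} {i'} i≤i' v∈ with to (∈level⇔ i) v∈
    ... | inj₁ v∈X = X⊆level i' v∈X
    ... | inj₂ v<i = from (∈level⇔ i') (inj₂ (<-≤-trans v<i i≤i'))

    elem∈level⇔ : ∀ i j → elem j ∈ level i ⇔ toℕ (block O j) < i
    elem∈level⇔ i j = mk⇔
      (λ j∈ → [ (λ j∈X → contradiction j∈X (elem∉X j))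
              , subst (λ k → toℕ (block O k) < i) (index-elem j) ]′ (to (∈level⇔ i) j∈))
      (λ j< → from (∈level⇔ i) (inj₂ (subst (λ k → toℕ (block O k) < i) (sym (index-elem j)) j<)))

    level-tube : (i : Fin (proj₁ O)) → IsTube G (level (toℕ i))
    level-tube i = ∋-universal⇒connected x-universal (X⊆level (toℕ i) x∈X) , elem j , λ j∈ →
      <⇒≱ (to (elem∈level⇔ _ j) j∈) (≤-reflexive (cong toℕ (sym block-j≡i)))
      where
      j = proj₁ (proj₂ (proj₂ O) i)
      block-j≡i = proj₂ (proj₂ (proj₂ O) i)

    IsLevel : Subset n → Set
    IsLevel s = ∃ λ (i : Fin (proj₁ O)) → s ≡ level (toℕ i)

    ψ? : ∀ s → Dec (T₀ s ≡ true ⊎ IsLevel s)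
    ψ? s = (T₀ s Bool.≟ true) ⊎-dec any? (λ i → ≡-dec Bool._≟_ s (level (toℕ i)))

    ψ : Collection n
    ψ s = does (ψ? s)

    ∈ψ⇔ : ∀ {s} → ψ s ≡ true ⇔ (T₀ s ≡ true ⊎ IsLevel s)
    ∈ψ⇔ {s} = does≡true⇔ (ψ? s)

    ψ-tubing : IsTubing G ψ
    ψ-tubing = tube , compatible
      where
      tube : ∀ s → ψ s ≡ true → IsTube G s
      tube s ψs with to ∈ψ⇔ ψs
      ... | inj₁ T₀s = proj₁ T₀-tubing s T₀s
      ... | inj₂ (i , refl) = level-tube i
      compatible : ∀ s t → ψ s ≡ true → ψ t ≡ true → Compatible G s t
      compatible s t ψs ψt with to ∈ψ⇔ ψs | to ∈ψ⇔ ψt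
      ... | inj₁ T₀s | inj₁ T₀t = proj₂ T₀-tubing s t T₀s T₀t
      ... | inj₁ T₀s | inj₂ (j , refl) = inj₁ (inj₁ (⊆-trans (T₀⊆X s T₀s) (X⊆level (toℕ j))))
      ... | inj₂ (i , refl) | inj₁ T₀t = inj₁ (inj₂ (⊆-trans (T₀⊆X t T₀t) (X⊆level (toℕ i))))
      ... | inj₂ (i , refl) | inj₂ (j , refl) with ≤-total (toℕ i) (toℕ j)
      ...   | inj₁ i≤j = inj₁ (inj₁ (level-mono i≤j))
      ...   | inj₂ j≤i = inj₁ (inj₂ (level-mono j≤i))

    ψ≤T₀ : ψ ≤ᵀ T₀
    ψ≤T₀ s T₀s = from ∈ψ⇔ (inj₁ T₀s)

    ≼ψ⇔≲ : ∀ j j' → elem j ≼[ ψ ] elem j' ⇔ j ≲[ O ] j'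
    ≼ψ⇔≲ j j' = mk⇔ ≼⇒≲ ≲⇒≼
      where
      ≲⇒≼ : j ≲[ O ] j' → elem j ≼[ ψ ] elem j'
      ≲⇒≼ j≲j' (ψt , _) j'∈t with to ∈ψ⇔ ψt
      ... | inj₁ T₀t = contradiction (T₀⊆X _ T₀t j'∈t) (elem∉X j')
      ... | inj₂ (i , refl) =
        from (elem∈level⇔ (toℕ i) j) (≤-<-trans j≲j' (to (elem∈level⇔ (toℕ i) j') j'∈t))
      ≼⇒≲ : elem j ≼[ ψ ] elem j' → j ≲[ O ] j'
      ≼⇒≲ j≼j' with suc (toℕ (block O j')) <? proj₁ O
      ... | no top = ≤-pred (<-≤-trans (toℕ<n (block O j)) (≮⇒≥ top))
      ... | yes below-top =
        ≤-pred (to (elem∈level⇔ next j)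
                   (j≼j' (ψ-next , X⊆level next) (from (elem∈level⇔ next j') ≤-refl)))
        where
        next = suc (toℕ (block O j'))
        ψ-next : ψ (level next) ≡ true
        ψ-next = from ∈ψ⇔ (inj₂ (fromℕ< below-top , cong level (sym (toℕ-fromℕ< below-top))))

    faces-above : FacesBelow G T₀
    faces-above = ψ , ψ-tubing , ψ≤T₀

    φ-faces-above≅ : φ faces-above ≤ᴾ O × O ≤ᴾ φ faces-above
    φ-faces-above≅ =
      from (≤ᴾ⇔≲-preserving (φ faces-above) O)
           (λ j j' → to (≼ψ⇔≲ j j') ∘ to (≲-φ⇔≼ faces-above j j')) ,
      from (≤ᴾ⇔≲-preserving O (φ faces-above))
           (λ j j' → from (≲-φ⇔≼ faces-above j j') ∘ from (≼ψ⇔≲ j j'))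

  isPermutohedronFace : IsPermutohedronFace G T₀ d
  isPermutohedronFace = φ , φ-≤⇔ , λ O → Levels.faces-above O , Levels.φ-faces-above≅ O

module SplitGraph (p q : ℕ) where

  open Equivalence

  G : Graph (p + q)
  G = SplitAdj p q

  toℕ-↑ˡ<p : ∀ (x' : Fin p) → toℕ (x' ↑ˡ q) < p
  toℕ-↑ˡ<p x' = subst (_< p) (sym (toℕ-↑ˡ x' q)) (toℕ<n x')

  p≤toℕ-↑ʳ : ∀ (w : Fin q) → p ≤ toℕ (p ↑ʳ w)
  p≤toℕ-↑ʳ w = subst (p ≤_) (sym (toℕ-↑ʳ p w)) (m≤m+n p (toℕ w))

  ↑ˡ≢↑ʳ : ∀ x' (w : Fin q) → x' ↑ˡ q ≢ p ↑ʳ w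
  ↑ˡ≢↑ʳ x' w eq = <⇒≱ (toℕ-↑ˡ<p x') (subst (λ v → p ≤ toℕ v) (sym eq) (p≤toℕ-↑ʳ w))

  ↑ˡ-universal : ∀ x' → IsUniversal G (x' ↑ˡ q)
  ↑ˡ-universal x' v v≢x = ((v≢x ∘ sym) , inj₁ (toℕ-↑ˡ<p x')) , (v≢x , inj₂ (toℕ-↑ˡ<p x'))

  ↑ʳ-independent : ∀ {S} → (∀ {v} → v ∈ S → ∃ λ (w : Fin q) → v ≡ p ↑ʳ w) → Independent G S
  ↑ʳ-independent in-Q u∈ v∈ (_ , inj₁ u<p) with in-Q u∈
  ... | w , refl = <⇒≱ u<p (p≤toℕ-↑ʳ w)
  ↑ʳ-independent in-Q u∈ v∈ (_ , inj₂ v<p) with in-Q v∈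
  ... | w , refl = <⇒≱ v<p (p≤toℕ-↑ʳ w)

  central : Fin p → Subset q → Subset (p + q)
  central x' K = ⁅ x' ⁆ ++ ∁ K

  IsFaceTube : Fin p → Subset q → Subset (p + q) → Set
  IsFaceTube x' K s = s ≡ central x' K ⊎ ∃ λ w → w ∉ K × s ≡ ⁅ p ↑ʳ w ⁆

  face? : ∀ x' K s → Dec (IsFaceTube x' K s)
  face? x' K s = ≡-dec Bool._≟_ s (central x' K)
           ⊎-dec any? (λ w → ¬? (w ∈? K) ×-dec ≡-dec Bool._≟_ s ⁅ p ↑ʳ w ⁆)

  face : Fin p → Subset q → Collection (p + q)
  face x' K s = does (face? x' K s)

  module _ (x' : Fin p) (K : Subset q) where

    ∈face⇔ : ∀ {s} → face x' K s ≡ true ⇔ IsFaceTube x' K s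
    ∈face⇔ {s} = does≡true⇔ (face? x' K s)

    ↑ˡ∈central : x' ↑ˡ q ∈ central x' K
    ↑ˡ∈central = from (∈-++ˡ⇔ ⁅ x' ⁆ (∁ K)) (x∈⁅x⁆ x')

    ↑ʳ∈central⇔ : ∀ {w} → p ↑ʳ w ∈ central x' K ⇔ w ∉ K
    ↑ʳ∈central⇔ = ⇔-trans (∈-++ʳ⇔ ⁅ x' ⁆ (∁ K)) (mk⇔ x∈∁p⇒x∉p x∉p⇒x∈∁p)

    ∈central⇒ : ∀ {v} → v ∈ central x' K → v ≡ x' ↑ˡ q ⊎ ∃ λ w → v ≡ p ↑ʳ w × w ∉ K
    ∈central⇒ {v} v∈ with ↑ˡ⊎↑ʳ p v
    ... | inj₁ (i , refl) =
      inj₁ (cong (_↑ˡ q) (x∈⁅y⁆⇒x≡y x' (to (∈-++ˡ⇔ ⁅ x' ⁆ (∁ K)) v∈)))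
    ... | inj₂ (w , refl) = inj₂ (w , refl , to ↑ʳ∈central⇔ v∈)

    ⁅↑ʳ⁆⊆central : ∀ {w} → w ∉ K → ⁅ p ↑ʳ w ⁆ ⊆ central x' K
    ⁅↑ʳ⁆⊆central w∉K v∈ rewrite x∈⁅y⁆⇒x≡y _ v∈ = from ↑ʳ∈central⇔ w∉K

    face⊆central : ∀ s → face x' K s ≡ true → s ⊆ central x' K
    face⊆central s face-s with to ∈face⇔ face-s
    ... | inj₁ refl = ⊆-refl
    ... | inj₂ (w , w∉K , refl) = ⁅↑ʳ⁆⊆central w∉K

    central∈face : face x' K (central x' K) ≡ true
    central∈face = from ∈face⇔ (inj₁ refl)

    ⁅↑ʳ⁆∈face : ∀ {w} → w ∉ K → face x' K ⁅ p ↑ʳ w ⁆ ≡ true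
    ⁅↑ʳ⁆∈face w∉K = from ∈face⇔ (inj₂ (_ , w∉K , refl))

    ↑ˡ∉⁅↑ʳ⁆ : ∀ {w} → x' ↑ˡ q ∉ ⁅ p ↑ʳ w ⁆
    ↑ˡ∉⁅↑ʳ⁆ {w} x∈ = ↑ˡ≢↑ʳ x' w (x∈⁅y⁆⇒x≡y _ x∈)

    face-isTubing : Nonempty K → IsTubing G (face x' K)
    face-isTubing (w₀ , w₀∈K) = tube , compatible
      where
      tube : ∀ s → face x' K s ≡ true → IsTube G s
      tube s face-s with to ∈face⇔ face-s
      ... | inj₁ refl = ∋-universal⇒connected (↑ˡ-universal x') ↑ˡ∈central ,
                        p ↑ʳ w₀ , λ w₀∈ → to ↑ʳ∈central⇔ w₀∈ w₀∈K
      ... | inj₂ (w , _ , refl) = ⁅⁆-connected _ , x' ↑ˡ q , ↑ˡ∉⁅↑ʳ⁆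
      compatible : ∀ s t → face x' K s ≡ true → face x' K t ≡ true → Compatible G s t
      compatible s t face-s face-t with to ∈face⇔ face-s | to ∈face⇔ face-t
      ... | inj₁ refl | _ = inj₁ (inj₂ (face⊆central t face-t))
      ... | inj₂ _ | inj₁ refl = inj₁ (inj₁ (face⊆central s face-s))
      ... | inj₂ (v , _ , refl) | inj₂ (w , _ , refl) with v Fin.≟ w
      ...   | yes refl = inj₁ (inj₁ ⊆-refl)
      ...   | no v≢w = inj₂ λ connected → v≢w (↑ʳ-injective p v w
                (independent-connected⇒≡ (↑ʳ-independent in-Q) connected
                  (p⊆p∪q ⁅ p ↑ʳ w ⁆ (x∈⁅x⁆ _)) (q⊆p∪q ⁅ p ↑ʳ v ⁆ _ (x∈⁅x⁆ _))))
        where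
        in-Q : ∀ {u} → u ∈ ⁅ p ↑ʳ v ⁆ ∪ ⁅ p ↑ʳ w ⁆ → ∃ λ (z : Fin q) → u ≡ p ↑ʳ z
        in-Q u∈ with x∈p∪q⁻ ⁅ p ↑ʳ v ⁆ ⁅ p ↑ʳ w ⁆ u∈
        ... | inj₁ u∈v = v , x∈⁅y⁆⇒x≡y _ u∈v
        ... | inj₂ u∈w = w , x∈⁅y⁆⇒x≡y _ u∈w

    ⊆central∌↑ˡ⇒↑ʳ : ∀ {s v} → s ⊆ central x' K → x' ↑ˡ q ∉ s →
      v ∈ s → ∃ λ w → v ≡ p ↑ʳ w × w ∉ K
    ⊆central∌↑ˡ⇒↑ʳ s⊆central x∉s v∈s with ∈central⇒ (s⊆central v∈s)
    ... | inj₁ refl = contradiction v∈s x∉s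
    ... | inj₂ in-Q = in-Q

    connected-⊆central∌↑ˡ⇒⁅↑ʳ⁆ : ∀ {s} → InducesConnected G s → s ⊆ central x' K →
      x' ↑ˡ q ∉ s → ∃ λ w → w ∉ K × s ≡ ⁅ p ↑ʳ w ⁆
    connected-⊆central∌↑ˡ⇒⁅↑ʳ⁆ s-connected@((z , z∈s) , _) s⊆central x∉s
      with ⊆central∌↑ˡ⇒↑ʳ s⊆central x∉s z∈s
    ... | w , refl , w∉K = w , w∉K , independent-connected⇒≡⁅⁆ s-independent s-connected z∈s
      where
      s-independent = ↑ʳ-independent (map₂ proj₁ ∘ ⊆central∌↑ˡ⇒↑ʳ s⊆central x∉s)

    face-saturated : ∀ S → IsTubing G S → S ≤ᵀ face x' K →
      ∀ s → S s ≡ true → face x' K s ≡ true ⊎ central x' K ⊆ s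
    face-saturated S (S-tube , S-compatible) S≤face s Ss with x' ↑ˡ q ∈? s
    ... | yes x∈s = inj₂ central⊆s
      where
      central⊆s : central x' K ⊆ s
      central⊆s v∈ with ∈central⇒ v∈
      ... | inj₁ refl = x∈s
      ... | inj₂ (w , refl , w∉K)
        with compatible-∋-universal⇒nested (↑ˡ-universal x')
               (S-compatible s _ Ss (S≤face _ (⁅↑ʳ⁆∈face w∉K))) x∈s
      ...   | inj₁ s⊆⁅w⁆ = contradiction (s⊆⁅w⁆ x∈s) ↑ˡ∉⁅↑ʳ⁆
      ...   | inj₂ ⁅w⁆⊆s = ⁅w⁆⊆s (x∈⁅x⁆ _)
    ... | no x∉s =
      inj₁ (from ∈face⇔ (inj₂ (connected-⊆central∌↑ˡ⇒⁅↑ʳ⁆ (proj₁ (S-tube s Ss)) s⊆central x∉s)))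
      where
      s⊆central : s ⊆ central x' K
      s⊆central with compatible-∋-universal⇒nested (↑ˡ-universal x')
                       (S-compatible _ s (S≤face _ central∈face) Ss) ↑ˡ∈central
      ... | inj₁ central⊆s = contradiction (central⊆s ↑ˡ∈central) x∉s
      ... | inj₂ s⊆central = s⊆central

    ∣∁central∣ : ∣ ∁ (central x' K) ∣ ≡ p ∸ 1 + ∣ K ∣
    ∣∁central∣ = begin
      ∣ ∁ (⁅ x' ⁆ ++ ∁ K) ∣       ≡⟨ cong ∣_∣ (map-++ not ⁅ x' ⁆ (∁ K)) ⟩
      ∣ ∁ ⁅ x' ⁆ ++ ∁ (∁ K) ∣     ≡⟨ ∣++∣ (∁ ⁅ x' ⁆) (∁ (∁ K)) ⟩
      ∣ ∁ ⁅ x' ⁆ ∣ + ∣ ∁ (∁ K) ∣  ≡⟨ cong₂ _+_ (∣∁p∣≡n∸∣p∣ ⁅ x' ⁆) (cong ∣_∣ (∁-involutive K)) ⟩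
      p ∸ ∣ ⁅ x' ⁆ ∣ + ∣ K ∣      ≡⟨ cong (λ k → p ∸ k + ∣ K ∣) (∣⁅x⁆∣≡1 x') ⟩
      p ∸ 1 + ∣ K ∣               ∎
      where open ≡-Reasoning

    face-isPermutohedronFace : Nonempty K → ∀ {d} → p ∸ 1 + ∣ K ∣ ≡ suc d →
      IsPermutohedronFace G (face x' K) d
    face-isPermutohedronFace K-nonempty size = PermutohedralFace.isPermutohedronFace
      (↑ˡ-universal x') (face-isTubing K-nonempty) ↑ˡ∈central central∈face face⊆central face-saturated
      (trans ∣∁central∣ size)

  face-injective : ∀ {x' y' K L} → (∀ s → face x' K s ≡ face y' L s) → x' ≡ y' × K ≡ L
  face-injective {x'} {y'} {K} {L} same with to (∈face⇔ y' L) (trans (sym (same _)) (central∈face x' K))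
  ... | inj₂ (w , _ , central≡⁅w⁆) =
    contradiction (subst (_ ∈_) central≡⁅w⁆ (↑ˡ∈central x' K)) (↑ˡ∉⁅↑ʳ⁆ x' K)
  ... | inj₁ central≡central with ++-injective ⁅ x' ⁆ ⁅ y' ⁆ central≡central
  ...   | ⁅x'⁆≡⁅y'⁆ , ∁K≡∁L =
    x∈⁅y⁆⇒x≡y y' (subst (x' ∈_) ⁅x'⁆≡⁅y'⁆ (x∈⁅x⁆ x')) ,
    trans (sym (∁-involutive K)) (trans (cong ∁ ∁K≡∁L) (∁-involutive L))

cast-injective : ∀ {m n} .(eq : m ≡ n) {i j : Fin m} → cast eq i ≡ cast eq j → i ≡ j
cast-injective eq {i} {j} ci≡cj =
  toℕ-injective (trans (sym (toℕ-cast eq i)) (trans (cong toℕ ci≡cj) (toℕ-cast eq j)))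

splitAt-injective : ∀ m {n} {i j : Fin (m + n)} → splitAt m i ≡ splitAt m j → i ≡ j
splitAt-injective m {n} {i} {j} eq =
  trans (sym (join-splitAt m n i)) (trans (cong (join m n) eq) (join-splitAt m n j))

remQuot-injective : ∀ {m} n {i j : Fin (m * n)} → remQuot {m} n i ≡ remQuot n j → i ≡ j
remQuot-injective {m} n {i} {j} eq =
  trans (sym (combine-remQuot {m} n i)) (trans (cong (uncurry combine) eq) (combine-remQuot {m} n j))

pascal : ∀ q k → Fin (suc q C suc k) → Fin (q C k) ⊎ Fin (q C suc k)
pascal q k = splitAt (q C k) ∘ cast (sym (nCk+nC[k+1]≡[n+1]C[k+1] q k))

pascal-injective : ∀ q k {i j} → pascal q k i ≡ pascal q k j → i ≡ j
pascal-injective q k = cast-injective (sym (nCk+nC[k+1]≡[n+1]C[k+1] q k)) ∘ splitAt-injective (q C k)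

kSubset : ∀ q k → Fin (q C k) → Subset q
kSubset q zero _ = ⊥
kSubset (suc q) (suc k) i with pascal q k i
... | inj₁ i' = true ∷ kSubset q k i'
... | inj₂ i' = false ∷ kSubset q (suc k) i'

∣kSubset∣ : ∀ q k i → ∣ kSubset q k i ∣ ≡ k
∣kSubset∣ q zero _ = ∣⊥∣≡0 q
∣kSubset∣ (suc q) (suc k) i with pascal q k i
... | inj₁ i' = cong suc (∣kSubset∣ q k i')
... | inj₂ i' = ∣kSubset∣ q (suc k) i'

kSubset-injective : ∀ q k {i j} → kSubset q k i ≡ kSubset q k j → i ≡ j
kSubset-injective q zero {Fin.zero} {Fin.zero} _ = refl
kSubset-injective (suc q) (suc k) {i} {j} eq with pascal q k i in eqi | pascal q k j in eqj
... | inj₁ i' | inj₁ j' = pascal-injective q k (trans eqi (trans (cong inj₁ i'≡j') (sym eqj)))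
  where i'≡j' = kSubset-injective q k (proj₂ (∷-injective eq))
... | inj₂ i' | inj₂ j' = pascal-injective q k (trans eqi (trans (cong inj₂ i'≡j') (sym eqj)))
  where i'≡j' = kSubset-injective q (suc k) (proj₂ (∷-injective eq))
... | inj₁ _ | inj₂ _ with () ← proj₁ (∷-injective eq)
... | inj₂ _ | inj₁ _ with () ← proj₁ (∷-injective eq)

m+[1+n]≡1+[[1+m]+[1+n]∸2] : ∀ m n → m + suc n ≡ suc (suc m + suc n ∸ 2)
m+[1+n]≡1+[[1+m]+[1+n]∸2] m n rewrite +-suc m n = refl

proposition2p1 : (p q k : ℕ) → 1 ≤ k → k ≤ q →
    Σ (Fin (p * (q C k)) → Collection (p + q)) λ F →
      (∀ i j → (∀ s → F i s ≡ F j s) → i ≡ j)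
      × (∀ i → IsTubing (SplitAdj p q) (F i)
               × IsPermutohedronFace (SplitAdj p q) (F i) (p + k ∸ 2))
proposition2p1 zero q k _ _ = (λ ()) , (λ ()) , (λ ())
proposition2p1 (suc p') q (suc k') _ _ =
  F , F-injective , λ i → uncurry tubing (remQuot _ i) , uncurry permutohedral (remQuot _ i)
  where
  open SplitGraph (suc p') q
  K : Fin (q C suc k') → Subset q
  K = kSubset q (suc k')
  K-nonempty : ∀ c → Nonempty (K c)
  K-nonempty c = ∣∣≡suc⇒nonempty (K c) (∣kSubset∣ q (suc k') c)
  F : Fin (suc p' * (q C suc k')) → Collection (suc p' + q)
  F = uncurry (λ x' c → face x' (K c)) ∘ remQuot _
  F-injective : ∀ i j → (∀ s → F i s ≡ F j s) → i ≡ j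
  F-injective i j same with face-injective same
  ... | x'≡y' , Kc≡Kd = remQuot-injective _ (cong₂ _,_ x'≡y' (kSubset-injective q (suc k') Kc≡Kd))
  tubing : ∀ x' c → IsTubing G (face x' (K c))
  tubing x' c = face-isTubing x' (K c) (K-nonempty c)
  permutohedral : ∀ x' c → IsPermutohedronFace G (face x' (K c)) (suc p' + suc k' ∸ 2)
  permutohedral x' c = face-isPermutohedronFace x' (K c) (K-nonempty c)
    (trans (cong (p' +_) (∣kSubset∣ q (suc k') c)) (m+[1+n]≡1+[[1+m]+[1+n]∸2] p' k'))
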